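{- Let $\mathbf{K}$ and $\mathbf{K}'$ be two enumerated left-dense Fra\"iss\'e limits of $\mathcal{K}$, and let $\rho:d\to k^{\mathsf{u}}$ be a sort. Then $P^{\mathbf{K}}(\rho)=P^{\mathbf{K}'}(\rho)$; that is, the poset $P(\rho)$ does not depend on the choice of left-dense enumerated Fra\"iss\'e limit.
   Context: Setting: finite relational language $\mathcal{L}=\{U_i:i<k^{\mathsf{u}}\}\cup\{R_i:i<k\}$ with conventions: each vertex satisfies exactly one $U_i$ ($U(a)=i$); $R_i(a,a)$ never; distinct $a,b$ satisfy exactly one $R_i(a,b)$ ($R(a,b)=i$); an involution $\mathrm{Flip}$ of $k$ fixing $0$ with $R_i(a,b)\iff R_{\mathrm{Flip}(i)}(b,a)$; $R=0$ means no relation. $\mathcal{F}$ a finite set of finite irreducible structures (irreducible: $R(a,b)\neq0$ for distinct $a,b$), $\mathcal{K}=\mathrm{Forb}(\mathcal{F})$. Standing assumption: every $i<k^{\mathsf{u}}$ is non-degenerate (some two-element structure in $\mathcal{K}$ has a vertex of unary $i$ and a nonzero relation). An enumerated structure has underlying set a cardinal; $\mathbf{M}_n$ is the induced structure on $\{0,\dots,n-1\}$. An enumerated Fra\"iss\'e limit $\mathbf{M}$ of $\mathcal{K}$ (underlying set $\omega$) is left dense if for every enumerated $\mathbf{B}\in\mathcal{K}$ with $|\mathbf{B}|=m+1$ and $\mathbf{B}_m=\mathbf{M}_m$ there is an order-preserving embedding $f:\mathbf{B}\to\mathbf{M}$ fixing $\{0,\dots,m-1\}$ with $R^{\mathbf{M}}(f(m),r)=0$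 for all $m\le r<f(m)$. $T=k^{\mathsf{u}}\times k^{<\omega}$, $T(n)$ the nodes $t=(t^{\mathsf{u}},t^{\mathsf{b}})$ with $|t^{\mathsf{b}}|=n$, $\preceq_{lex}$ compares unaries then lexicographically. For such $\mathbf{M}$, the coding map $c^{\mathbf{M}}(n)\in T(n)$ has $c^{\mathbf{M}}(n)^{\mathsf{u}}=U^{\mathbf{M}}(n)$ and $c^{\mathbf{M}}(n)^{\mathsf{b}}(m)=R^{\mathbf{M}}(n,m)$ for $m<n$; $\mathrm{CT}^{\mathbf{M}}(n)$ is the set of restrictions to length $n$ of coding nodes $c^{\mathbf{M}}(a)$, $a\ge n$. An $\mathcal{L}_d$-structure has the binary symbols plus unaries $V_0,\dots,V_{d-1}$ partitioning its vertices. For $S=\{s_0\prec_{lex}\dots\prec_{lex}s_{d-1}\}\subseteq T(n)$, $\mathbf{B}[S,\mathbf{M}]$ is the $\mathcal{L}$-structure on $\{0,\dots,n-1\}\cup B$ equal to $\mathbf{M}_n$ on $\{0,\dots,n-1\}$, with the binary part of $\mathbf{B}$ on $B$, $U(b)=s_{V(b)}^{\mathsf{u}}$, $R(b,x)=s_{V(b)}^{\mathsf{b}}(x)$; $\mathcal{K}^{\mathbf{M}}(S)=\{\mathbf{B}\text{ finite}:\mathbf{B}[S,\mathbf{M}]\in\mathcal{K}\}$. For a sort $\rho:d\to k^{\mathsf{u}}$, $P^{\mathbf{M}}(\rho)=\{\mathcal{K}^{\mathbf{M}}(S): S\subseteq\mathrm{CT}^{\mathbf{M}}(n)\text{ for some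 }n,\ (s_j^{\mathsf{u}})_{j<d}=\rho\}$. -}

module Defs where

open import Data.Nat as ℕ using (ℕ; zero; suc; _≤_; _<_)
open import Data.Fin as Fin using (Fin; toℕ; inject₁; fromℕ)
open import Data.Product using (Σ; ∃; _×_; _,_; proj₁; proj₂)
open import Data.Sum using (_⊎_; inj₁; inj₂)
open import Data.List using (List)
open import Data.List.Relation.Unary.All using (All)
open import Relation.Binary.PropositionalEquality using (_≡_; _≢_)
open import Relation.Nullary using (¬_)
open import Function.Bundles using (_⇔_)

-- The language: k^u unary symbols U_i (i < ku), k = suc k₀ binary symbols R_i
-- (R_0 = "no relation"), and the involution Flip of k fixing 0.
record Lang : Set where
  field
    ku        : ℕ
    k₀        : ℕ
    Flip      : Fin (suc k₀) → Fin (suc k₀)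
    Flip-inv  : ∀ i → Flip (Flip i) ≡ i
    Flip-zero : Flip Fin.zero ≡ Fin.zero

module Setting (L : Lang) where
  open Lang L

  k : ℕ
  k = suc k₀

  BinRel : Set
  BinRel = Fin k

  noRel : BinRel
  noRel = Fin.zero

  record Struct (A : Set) : Set where
    field
      U : A → Fin ku
      R : A → A → BinRel
  open Struct public

  Valid : {A : Set} → Struct A → Set
  Valid {A} M = (∀ a → R M a a ≡ noRel) × (∀ a b → R M a b ≡ Flip (R M b a))

  FinStruct : Set
  FinStruct = Σ ℕ λ m → Struct (Fin m)

  Irreducible : FinStruct → Set
  Irreducible (m , A) = ∀ (a b : Fin m) → a ≢ b → R A a b ≢ noRel

  record Embedding {A B : Set} (SA : Struct A) (SB : Struct B) : Set where
    field
      map   : A → B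
      inj   : ∀ a a' → map a ≡ map a' → a ≡ a'
      presU : ∀ a → U SB (map a) ≡ U SA a
      presR : ∀ a a' → R SB (map a) (map a') ≡ R SA a a'

  InForb : List FinStruct → {A : Set} → Struct A → Set
  InForb 𝓕 SA = All (λ F → ¬ Embedding (proj₂ F) SA) 𝓕

  NonDegenerate : List FinStruct → Set
  NonDegenerate 𝓕 = ∀ (i : Fin ku) → Σ (Struct (Fin 2)) λ A →
    Valid A × InForb 𝓕 A × (Σ (Fin 2) λ a → U A a ≡ i) ×
    R A Fin.zero (Fin.suc Fin.zero) ≢ noRel

  IsFraisseLimit : List FinStruct → Struct ℕ → Set
  IsFraisseLimit 𝓕 M =
    Valid M ×
    (∀ (m : ℕ) (A : Struct (Fin m)) → Valid A → (InForb 𝓕 A ⇔ Embedding A M)) ×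
    (∀ (m : ℕ) (f g : Fin m → ℕ) →
       (∀ i j → f i ≡ f j → i ≡ j) → (∀ i j → g i ≡ g j → i ≡ j) →
       (∀ i → U M (f i) ≡ U M (g i)) → (∀ i j → R M (f i) (f j) ≡ R M (g i) (g j)) →
       Σ (ℕ → ℕ) λ σ → Σ (ℕ → ℕ) λ τ →
         (∀ x → σ (τ x) ≡ x) × (∀ x → τ (σ x) ≡ x) ×
         (∀ x → U M (σ x) ≡ U M x) × (∀ x y → R M (σ x) (σ y) ≡ R M x y) ×
         (∀ i → σ (f i) ≡ g i))

  LeftDense : List FinStruct → Struct ℕ → Set
  LeftDense 𝓕 M =
    ∀ (m : ℕ) (B : Struct (Fin (suc m))) → Valid B → InForb 𝓕 B →
    (∀ (i : Fin m) → U B (inject₁ i) ≡ U M (toℕ i)) →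
    (∀ (i j : Fin m) → R B (inject₁ i) (inject₁ j) ≡ R M (toℕ i) (toℕ j)) →
    Σ (Embedding B M) λ f →
      (∀ (i j : Fin (suc m)) → i Fin.< j → Embedding.map f i < Embedding.map f j) ×
      (∀ (i : Fin m) → Embedding.map f (inject₁ i) ≡ toℕ i) ×
      (∀ (r : ℕ) → m ≤ r → r < Embedding.map f (fromℕ m) →
         R M (Embedding.map f (fromℕ m)) r ≡ noRel)

  Node : ℕ → Set
  Node n = Fin ku × (Fin n → BinRel)

  SeqLex : {n : ℕ} → (Fin n → BinRel) → (Fin n → BinRel) → Set
  SeqLex {n} b b' = Σ (Fin n) λ i → (∀ j → j Fin.< i → b j ≡ b' j) × b i Fin.< b' i

  _≺lex_ : {n : ℕ} → Node n → Node n → Set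
  (u , b) ≺lex (u' , b') = (u Fin.< u') ⊎ ((u ≡ u') × SeqLex b b')

  InCT : Struct ℕ → (n : ℕ) → Node n → Set
  InCT M n (u , b) = Σ ℕ λ a → (n ≤ a) × (U M a ≡ u) × (∀ (i : Fin n) → R M a (toℕ i) ≡ b i)

  -- L_d-structures: binary part plus a partition V into d colours
  record DStruct (d : ℕ) (A : Set) : Set where
    field
      V  : A → Fin d
      RB : A → A → BinRel
  open DStruct public

  DValid : {d : ℕ} {A : Set} → DStruct d A → Set
  DValid B = (∀ a → RB B a a ≡ noRel) × (∀ a b → RB B a b ≡ Flip (RB B b a))

  -- S = {s_0 ≺lex … ≺lex s_{d-1}} ⊆ CT^M(n) of sort ρ, given by its lex-increasing enumeration
  Admissible : Struct ℕ → (d : ℕ) → (Fin d → Fin ku) → (n : ℕ) → (Fin d → Node n) → Set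
  Admissible M d ρ n s =
    (∀ i j → i Fin.< j → s i ≺lex s j) × (∀ j → InCT M n (s j)) × (∀ j → proj₁ (s j) ≡ ρ j)

  BS : {d n m : ℕ} → (Fin d → Node n) → Struct ℕ → DStruct d (Fin m) → Struct (Fin n ⊎ Fin m)
  U (BS s M B) (inj₁ x) = U M (toℕ x)
  U (BS s M B) (inj₂ b) = proj₁ (s (V B b))
  R (BS s M B) (inj₁ x) (inj₁ y) = R M (toℕ x) (toℕ y)
  R (BS s M B) (inj₂ b) (inj₂ b') = RB B b b'
  R (BS s M B) (inj₂ b) (inj₁ x) = proj₂ (s (V B b)) x
  R (BS s M B) (inj₁ x) (inj₂ b) = Flip (proj₂ (s (V B b)) x)

  InKM : List FinStruct → {d n m : ℕ} → Struct ℕ → (Fin d → Node n) → DStruct d (Fin m) → Set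
  InKM 𝓕 M s B = InForb 𝓕 (BS s M B)

  SameClass : List FinStruct → {d n n' : ℕ} → Struct ℕ → (Fin d → Node n) →
              Struct ℕ → (Fin d → Node n') → Set
  SameClass 𝓕 {d} M s M' s' =
    ∀ (m : ℕ) (B : DStruct d (Fin m)) → DValid B → (InKM 𝓕 M s B ⇔ InKM 𝓕 M' s' B)

  PSubset : List FinStruct → (d : ℕ) → (Fin d → Fin ku) → Struct ℕ → Struct ℕ → Set
  PSubset 𝓕 d ρ M M' =
    ∀ (n : ℕ) (s : Fin d → Node n) → Admissible M d ρ n s →
    Σ ℕ λ n' → Σ (Fin d → Node n') λ s' → Admissible M' d ρ n' s' × SameClass 𝓕 M s M' s'

  PEqual : List FinStruct → (d : ℕ) → (Fin d → Fin ku) → Struct ℕ → Struct ℕ → Set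
  PEqual 𝓕 d ρ M M' = PSubset 𝓕 d ρ M M' × PSubset 𝓕 d ρ M' M

module Submission where

-- Compare K with K' along an order-preserving embedding g of K_n into an initial segment K'_N,
-- built point by point: the next point of K goes to a point w of K' above N whose relations to
-- the image of g copy those in K and which is unrelated to the rest of K'_N. Left density
-- provides w, because this one-point extension of K'_N omits 𝓕: forbidden structures are
-- irreducible, so a copy through the new point lies over the image of g and hence comes from K.
-- The same construction sends each coding node s_j of S ⊆ CT^K(n) to a coding node s'_j of K'
-- at level N; the same irreducibility argument gives 𝒦^K(S) = 𝒦^K'(S'), and since every s'_j
-- vanishes off the image of the monotone map g, the lexicographic order is preserved.

open import Defs
open import Data.Nat using (ℕ; zero; suc; _≤_; _<_)
open import Data.Nat.Properties using (≤-refl; <-≤-trans; <-irrefl; <-asym; ≮⇒≥; <⇒≱; n<1+n; m<n⇒m<1+n)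
open import Data.Fin as Fin using (Fin; toℕ; fromℕ; fromℕ<; inject₁)
open import Data.Fin.Properties using (toℕ-fromℕ<; toℕ-fromℕ; toℕ-inject₁; toℕ-injective; fromℕ≢inject₁; ≤fromℕ; toℕ<n; any?; <-cmp)
open import Data.Fin.Relation.Unary.Top using (View; view; ‵fromℕ; ‵inj₁; view-inject₁; view-fromℕ)
open import Data.List using (List)
open import Data.List.Relation.Unary.All as All using (All)
open import Data.Product using (Σ; ∃; _×_; _,_; proj₁; proj₂)
open import Data.Sum as Sum using (_⊎_; inj₁; inj₂; [_,_]′)
open import Data.Sum.Properties using (inj₁-injective; inj₂-injective)
open import Data.Empty using (⊥-elim)
open import Function using (id)
open import Function.Bundles using (_⇔_; mk⇔; Equivalence)
open import Relation.Binary using (tri<; tri≈; tri>; _Preserves_⟶_)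
open import Relation.Binary.PropositionalEquality
open import Relation.Nullary using (Dec; yes; no; ¬_)
open import Relation.Nullary.Decidable using (decidable-stable)

snocᵛ : {A : Set} {p : ℕ} → (Fin p → A) → A → {i : Fin (suc p)} → View i → A
snocᵛ f a ‵fromℕ = a
snocᵛ f a (‵inj₁ {i = j} _) = f j

snoc : {A : Set} {p : ℕ} → (Fin p → A) → A → Fin (suc p) → A
snoc f a i = snocᵛ f a (view i)

snoc-inject₁ : {A : Set} {p : ℕ} (f : Fin p → A) (a : A) (j : Fin p) → snoc f a (inject₁ j) ≡ f j
snoc-inject₁ f a j = cong (snocᵛ f a) (view-inject₁ j)

snoc-fromℕ : {A : Set} {p : ℕ} (f : Fin p → A) (a : A) → snoc f a (fromℕ p) ≡ a
snoc-fromℕ {p = p} f a = cong (snocᵛ f a) (view-fromℕ p)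

module Development (L : Lang) where
  open Lang L
  open Setting L
  open Embedding

  comap : {A B : Set} → (A → B) → Struct B → Struct A
  U (comap f S) a = U S (f a)
  R (comap f S) a a' = R S (f a) (f a')

  _↾_ : Struct ℕ → (n : ℕ) → Struct (Fin n)
  M ↾ n = comap toℕ M

  code : Struct ℕ → ℕ → (n : ℕ) → Node n
  code M a n = U M a , λ i → R M a (toℕ i)

  _≋_ : {n : ℕ} → Node n → Node n → Set
  t ≋ t' = proj₁ t ≡ proj₁ t' × (∀ i → proj₂ t i ≡ proj₂ t' i)

  idᵉ : {A : Set} {S : Struct A} → Embedding S S
  idᵉ = record { map = id ; inj = λ _ _ eq → eq ; presU = λ _ → refl ; presR = λ _ _ → refl }

  _∘ᵉ_ : {A B C : Set} {SA : Struct A} {SB : Struct B} {SC : Struct C} →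
         Embedding SB SC → Embedding SA SB → Embedding SA SC
  g ∘ᵉ f = record
    { map = λ a → map g (map f a)
    ; inj = λ a a' eq → inj f a a' (inj g _ _ eq)
    ; presU = λ a → trans (presU g (map f a)) (presU f a)
    ; presR = λ a a' → trans (presR g _ _) (presR f a a') }

  comap-embedding : {A B : Set} {S : Struct B} (f : A → B) →
                    (∀ a a' → f a ≡ f a' → a ≡ a') → Embedding (comap f S) S
  comap-embedding f f-inj = record { map = f ; inj = f-inj ; presU = λ _ → refl ; presR = λ _ _ → refl }

  ↾-embedding : {M : Struct ℕ} {n : ℕ} → Embedding (M ↾ n) M
  ↾-embedding = comap-embedding toℕ (λ _ _ → toℕ-injective)

  ↾-restrict : {A : Set} {S : Struct A} {M : Struct ℕ} {N : ℕ} (e : Embedding S M) →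
               (∀ a → map e a < N) → Embedding S (M ↾ N)
  ↾-restrict {M = M} e below = record
    { map = λ a → fromℕ< (below a)
    ; inj = λ a a' eq → inj e a a' (trans (sym (toℕ-fromℕ< (below a)))
                                     (trans (cong toℕ eq) (toℕ-fromℕ< (below a'))))
    ; presU = λ a → trans (cong (U M) (toℕ-fromℕ< (below a))) (presU e a)
    ; presR = λ a a' → trans (cong₂ (R M) (toℕ-fromℕ< (below a)) (toℕ-fromℕ< (below a')))
                             (presR e a a') }

  pullback : {A B C : Set} {S : Struct A} {T : Struct B} {F : Struct C}
             (φ : Embedding S T) (e : Embedding F T) →
             (∀ c → ∃ λ a → map φ a ≡ map e c) → Embedding F S
  pullback {T = T} φ e cover = record
    { map = λ c → proj₁ (cover c)
    ; inj = λ c c' eq → inj e c c' (trans (sym (proj₂ (cover c)))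
                                     (trans (cong (map φ) eq) (proj₂ (cover c'))))
    ; presU = λ c → trans (sym (presU φ _)) (trans (cong (U T) (proj₂ (cover c))) (presU e c))
    ; presR = λ c c' → trans (sym (presR φ _ _))
                        (trans (cong₂ (R T) (proj₂ (cover c)) (proj₂ (cover c'))) (presR e c c')) }

  comap-valid : {A B : Set} {S : Struct B} (f : A → B) → Valid S → Valid (comap f S)
  comap-valid f (diag , flip) = (λ a → diag (f a)) , (λ a a' → flip (f a) (f a'))

  BS-valid : {d n m : ℕ} {s : Fin d → Node n} {M : Struct ℕ} {B : DStruct d (Fin m)} →
             Valid M → DValid B → Valid (BS s M B)
  BS-valid {s = s} {B = B} (diagM , flipM) (diagB , flipB) = diag , flip
    where
      diag : ∀ z → R (BS s _ B) z z ≡ noRel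
      diag (inj₁ x) = diagM (toℕ x)
      diag (inj₂ b) = diagB b
      flip : ∀ z z' → R (BS s _ B) z z' ≡ Flip (R (BS s _ B) z' z)
      flip (inj₁ x) (inj₁ y) = flipM (toℕ x) (toℕ y)
      flip (inj₁ x) (inj₂ b) = refl
      flip (inj₂ b) (inj₁ x) = sym (Flip-inv _)
      flip (inj₂ b) (inj₂ b') = flipB b b'

  InForb-reflect : {𝓕 : List FinStruct} {A B : Set} {S : Struct A} {T : Struct B} →
                   Embedding S T → InForb 𝓕 T → InForb 𝓕 S
  InForb-reflect φ = All.map (λ ¬e e → ¬e (φ ∘ᵉ e))

  limit-InForb : {𝓕 : List FinStruct} {M : Struct ℕ} → All (λ F → Valid (proj₂ F)) 𝓕 →
                 IsFraisseLimit 𝓕 M → InForb 𝓕 M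
  limit-InForb valid (_ , age , _) = All.tabulate λ {F} F∈𝓕 e →
    All.lookup (Equivalence.from (age _ (proj₂ F) (All.lookup valid F∈𝓕)) e) F∈𝓕 idᵉ

  irreducible-copy : {F : FinStruct} {A : Set} {S : Struct A} → Irreducible F →
                     (e : Embedding (proj₂ F) S) → ∀ a a' → R S (map e a) (map e a') ≡ noRel → a ≡ a'
  irreducible-copy irr e a a' unrelated =
    decidable-stable (a Fin.≟ a') λ a≢a' → irr a a' a≢a' (trans (sym (presR e a a')) unrelated)

  preimage? : {n N : ℕ} (g : Fin n → Fin N) (y : Fin N) → Dec (∃ λ x → g x ≡ y)
  preimage? g y = any? (λ x → g x Fin.≟ y)

  record Transports {n N : ℕ} (g : Fin n → Fin N) (t : Node n) (t' : Node N) : Set where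
    field
      unary : proj₁ t' ≡ proj₁ t
      image : ∀ x → proj₂ t' (g x) ≡ proj₂ t x
      gap   : ∀ y → ¬ (∃ λ x → g x ≡ y) → proj₂ t' y ≡ noRel

  Transports-≋ˡ : {n N : ℕ} {g : Fin n → Fin N} {t₀ t : Node n} {t' : Node N} →
                  t₀ ≋ t → Transports g t₀ t' → Transports g t t'
  Transports-≋ˡ (u≡ , b≡) T = record
    { unary = trans (Transports.unary T) u≡
    ; image = λ x → trans (Transports.image T x) (b≡ x)
    ; gap = Transports.gap T }

  Transports-≋ʳ : {n N : ℕ} {g : Fin n → Fin N} {t : Node n} {t₀ t' : Node N} →
                  t' ≋ t₀ → Transports g t t₀ → Transports g t t'
  Transports-≋ʳ (u≡ , b≡) T = record
    { unary = trans u≡ (Transports.unary T)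
    ; image = λ x → trans (b≡ _) (Transports.image T x)
    ; gap = λ y y∉ → trans (b≡ y) (Transports.gap T y y∉) }

  push : {n N : ℕ} → (Fin n → Fin N) → Node n → Node N
  push g (u , b) = u , λ y → pushed (preimage? g y)
    where
      pushed : ∀ {y} → Dec (∃ λ x → g x ≡ y) → BinRel
      pushed (yes (x , _)) = b x
      pushed (no _) = noRel

  push-transports : {n N : ℕ} {g : Fin n → Fin N} (t : Node n) →
                    (∀ x x' → g x ≡ g x' → x ≡ x') → Transports g t (push g t)
  push-transports {g = g} (u , b) g-inj = record { unary = refl ; image = image ; gap = gap }
    where
      image : ∀ x → proj₂ (push g (u , b)) (g x) ≡ b x
      image x with preimage? g (g x)
      ... | yes (x' , eq) = cong b (g-inj x' x eq)
      ... | no ∄ = ⊥-elim (∄ (x , refl))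
      gap : ∀ y → ¬ (∃ λ x → g x ≡ y) → proj₂ (push g (u , b)) y ≡ noRel
      gap y y∉ with preimage? g y
      ... | yes x↦y = ⊥-elim (y∉ x↦y)
      ... | no _ = refl

  inj₂? : {A B : Set} (z : A ⊎ B) → Dec (∃ λ b → z ≡ inj₂ b)
  inj₂? (inj₁ _) = no λ ()
  inj₂? (inj₂ b) = yes (b , refl)

  BS-base : {d n m : ℕ} {s : Fin d → Node n} {M : Struct ℕ} {B : DStruct d (Fin m)} →
            Embedding (M ↾ n) (BS s M B)
  BS-base = record
    { map = inj₁ ; inj = λ _ _ → inj₁-injective ; presU = λ _ → refl ; presR = λ _ _ → refl }

  module _ {d n N m : ℕ} {M M' : Struct ℕ} {s : Fin d → Node n} {s' : Fin d → Node N}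
           (g : Embedding (M ↾ n) (M' ↾ N)) (T : ∀ j → Transports (map g) (s j) (s' j))
           (B : DStruct d (Fin m)) where

    BS-map : Embedding (BS s M B) (BS s' M' B)
    BS-map = record { map = φ ; inj = φ-inj ; presU = φ-U ; presR = φ-R }
      where
        φ : Fin n ⊎ Fin m → Fin N ⊎ Fin m
        φ = Sum.map (map g) id
        φ-inj : ∀ z z' → φ z ≡ φ z' → z ≡ z'
        φ-inj (inj₁ x) (inj₁ x') eq = cong inj₁ (inj g x x' (inj₁-injective eq))
        φ-inj (inj₂ b) (inj₂ b') eq = cong inj₂ (inj₂-injective eq)
        φ-U : ∀ z → U (BS s' M' B) (φ z) ≡ U (BS s M B) z
        φ-U (inj₁ x) = presU g x
        φ-U (inj₂ b) = Transports.unary (T (V B b))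
        φ-R : ∀ z z' → R (BS s' M' B) (φ z) (φ z') ≡ R (BS s M B) z z'
        φ-R (inj₁ x) (inj₁ x') = presR g x x'
        φ-R (inj₁ x) (inj₂ b) = cong Flip (Transports.image (T (V B b)) x)
        φ-R (inj₂ b) (inj₁ x) = Transports.image (T (V B b)) x
        φ-R (inj₂ b) (inj₂ b') = refl

    -- A copy meeting B has all its other vertices related to that vertex of B, so by the gap
    -- condition it avoids the part of M'_N outside the image of g.
    copy-pulls-back : {F : FinStruct} → Irreducible F → (e : Embedding (proj₂ F) (BS s' M' B)) →
                      Embedding (proj₂ F) (BS s M B) ⊎ Embedding (proj₂ F) M'
    copy-pulls-back irr e with any? (λ c → inj₂? (map e c))
    ... | yes (c₀ , b₀ , ec₀≡b₀) = inj₁ (pullback BS-map e cover)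
      where
        cover : ∀ c → ∃ λ z → map BS-map z ≡ map e c
        cover c with map e c in ec≡
        ... | inj₂ b = inj₂ b , refl
        ... | inj₁ y with preimage? (map g) y
        ...   | yes (x , gx≡y) = inj₁ x , cong inj₁ gx≡y
        ...   | no y∉ = ⊥-elim (inj₂≢inj₁ (trans (sym ec₀≡b₀) (trans (cong (map e) c₀≡c) ec≡)))
          where
            inj₂≢inj₁ : inj₂ b₀ ≢ inj₁ y
            inj₂≢inj₁ ()
            c₀≡c : c₀ ≡ c
            c₀≡c = irreducible-copy irr e c₀ c
              (trans (cong₂ (R (BS s' M' B)) ec₀≡b₀ ec≡) (Transports.gap (T (V B b₀)) y y∉))
    ... | no ∄ = inj₂ (↾-embedding ∘ᵉ pullback BS-base e old)
      where
        old : ∀ c → ∃ λ y → inj₁ y ≡ map e c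
        old c with map e c in ec≡
        ... | inj₁ y = y , refl
        ... | inj₂ b = ⊥-elim (∄ (c , b , ec≡))

    transfer : {𝓕 : List FinStruct} → All Irreducible 𝓕 → InForb 𝓕 M' →
               InKM 𝓕 M s B ⇔ InKM 𝓕 M' s' B
    transfer irreducible forbM' = mk⇔
      (λ forbA → All.zipWith (λ (irr , ¬A , ¬M') e → [ ¬A , ¬M' ]′ (copy-pulls-back irr e))
                             (irreducible , All.zip (forbA , forbM')))
      (InForb-reflect BS-map)

  reflects-< : {n N : ℕ} {g : Fin n → Fin N} → g Preserves Fin._<_ ⟶ Fin._<_ →
               ∀ x y → g x Fin.< g y → x Fin.< y
  reflects-< mono x y gx<gy with <-cmp x y
  ... | tri< x<y _ _ = x<y
  ... | tri≈ _ refl _ = ⊥-elim (<-irrefl refl gx<gy)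
  ... | tri> _ _ y<x = ⊥-elim (<-asym gx<gy (mono y<x))

  ≺lex-transport : {n N : ℕ} {g : Fin n → Fin N} {t₁ t₂ : Node n} {t₁' t₂' : Node N} →
                   g Preserves Fin._<_ ⟶ Fin._<_ → Transports g t₁ t₁' → Transports g t₂ t₂' →
                   t₁ ≺lex t₂ → t₁' ≺lex t₂'
  ≺lex-transport _ T₁ T₂ (inj₁ u₁<u₂) =
    inj₁ (subst₂ Fin._<_ (sym (Transports.unary T₁)) (sym (Transports.unary T₂)) u₁<u₂)
  ≺lex-transport {g = g} {t₁' = t₁'} {t₂'} mono T₁ T₂ (inj₂ (u₁≡u₂ , i₀ , agree , differ)) =
    inj₂ ( trans (Transports.unary T₁) (trans u₁≡u₂ (sym (Transports.unary T₂)))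
         , g i₀ , agree'
         , subst₂ Fin._<_ (sym (Transports.image T₁ i₀)) (sym (Transports.image T₂ i₀)) differ)
    where
      agree' : ∀ y → y Fin.< g i₀ → proj₂ t₁' y ≡ proj₂ t₂' y
      agree' y y<gi₀ with preimage? g y
      ... | yes (x , refl) = trans (Transports.image T₁ x)
                              (trans (agree x (reflects-< mono x i₀ y<gi₀)) (sym (Transports.image T₂ x)))
      ... | no y∉ = trans (Transports.gap T₁ y y∉) (sym (Transports.gap T₂ y y∉))

  point : DStruct 1 (Fin 1)
  V point _ = Fin.zero
  RB point _ _ = noRel

  point-valid : DValid point
  point-valid = (λ _ → refl) , (λ _ _ → sym Flip-zero)

  adjoin : Struct ℕ → {N : ℕ} → Node N → Struct (Fin N ⊎ Fin 1)
  adjoin M t = BS (λ _ → t) M point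

  BS-code-embedding : {M : Struct ℕ} {p a : ℕ} → Valid M → p ≤ a →
                      Embedding (adjoin M (code M a p)) M
  BS-code-embedding {M} {p} {a} (diag , flip) p≤a =
    record { map = place ; inj = inj′ ; presU = presU′ ; presR = presR′ }
    where
      place : Fin p ⊎ Fin 1 → ℕ
      place = [ toℕ , (λ _ → a) ]′
      inj′ : ∀ z z' → place z ≡ place z' → z ≡ z'
      inj′ (inj₁ x) (inj₁ x') eq = cong inj₁ (toℕ-injective eq)
      inj′ (inj₁ x) (inj₂ _) eq = ⊥-elim (<-irrefl eq (<-≤-trans (toℕ<n x) p≤a))
      inj′ (inj₂ _) (inj₁ x') eq = ⊥-elim (<-irrefl (sym eq) (<-≤-trans (toℕ<n x') p≤a))
      inj′ (inj₂ Fin.zero) (inj₂ Fin.zero) _ = refl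
      presU′ : ∀ z → U M (place z) ≡ U (adjoin M (code M a p)) z
      presU′ (inj₁ _) = refl
      presU′ (inj₂ _) = refl
      presR′ : ∀ z z' → R M (place z) (place z') ≡ R (adjoin M (code M a p)) z z'
      presR′ (inj₁ _) (inj₁ _) = refl
      presR′ (inj₁ x) (inj₂ _) = flip (toℕ x) a
      presR′ (inj₂ _) (inj₁ _) = refl
      presR′ (inj₂ _) (inj₂ _) = diag a

  split : {N : ℕ} → Fin (suc N) → Fin N ⊎ Fin 1
  split = snoc inj₁ (inj₂ Fin.zero)

  split-inject₁ : {N : ℕ} (i : Fin N) → split (inject₁ i) ≡ inj₁ i
  split-inject₁ = snoc-inject₁ inj₁ (inj₂ Fin.zero)

  split-fromℕ : (N : ℕ) → split (fromℕ N) ≡ inj₂ Fin.zero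
  split-fromℕ N = snoc-fromℕ inj₁ (inj₂ Fin.zero)

  split-injective : {N : ℕ} (i j : Fin (suc N)) → split i ≡ split j → i ≡ j
  split-injective i j eq = trans (sym (join-split i)) (trans (cong join eq) (join-split j))
    where
      join : {N : ℕ} → Fin N ⊎ Fin 1 → Fin (suc N)
      join {N} = [ inject₁ , (λ _ → fromℕ N) ]′
      join-splitᵛ : {N : ℕ} {i : Fin (suc N)} (v : View i) → join (snocᵛ inj₁ (inj₂ Fin.zero) v) ≡ i
      join-splitᵛ ‵fromℕ = refl
      join-splitᵛ (‵inj₁ _) = refl
      join-split : {N : ℕ} (i : Fin (suc N)) → join (split i) ≡ i
      join-split i = join-splitᵛ (view i)

  one-point-extension : {𝓕 : List FinStruct} {M : Struct ℕ} → LeftDense 𝓕 M → Valid M →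
                        {N : ℕ} (t : Node N) → InKM 𝓕 M (λ _ → t) point →
                        Σ ℕ λ w → N ≤ w × code M w N ≋ t
  one-point-extension {M = M} dense valid {N} t forb
    with dense N (comap split (adjoin M t))
                 (comap-valid {S = adjoin M t} split (BS-valid valid point-valid))
                 (InForb-reflect (comap-embedding split split-injective) forb)
                 (λ i → cong (U (adjoin M t)) (split-inject₁ i))
                 (λ i j → cong₂ (R (adjoin M t)) (split-inject₁ i) (split-inject₁ j))
  ... | f , _ , fixes , _ = w , N≤w , unary , binary
    where
      w : ℕ
      w = map f (fromℕ N)
      unary : U M w ≡ proj₁ t
      unary = trans (presU f (fromℕ N)) (cong (U (adjoin M t)) (split-fromℕ N))
      binary : ∀ i → R M w (toℕ i) ≡ proj₂ t i
      binary i = begin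
        R M w (toℕ i)                                   ≡⟨ cong (R M w) (sym (fixes i)) ⟩
        R M w (map f (inject₁ i))                       ≡⟨ presR f (fromℕ N) (inject₁ i) ⟩
        R (adjoin M t) (split (fromℕ N)) (split (inject₁ i))
          ≡⟨ cong₂ (R (adjoin M t)) (split-fromℕ N) (split-inject₁ i) ⟩
        proj₂ t i                                       ∎
        where open ≡-Reasoning
      N≤w : N ≤ w
      N≤w = ≮⇒≥ λ w<N →
        fromℕ≢inject₁ (inj f _ _ (trans (sym (toℕ-fromℕ< w<N)) (sym (fixes (fromℕ< w<N)))))

  snoc-embedding : {M M' : Struct ℕ} {p : ℕ} → Valid M → Valid M' →
                   (e : Embedding (M ↾ p) M') (w : ℕ) → (∀ x → map e x ≢ w) →
                   U M' w ≡ U M p → (∀ x → R M' w (map e x) ≡ R M p (toℕ x)) →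
                   Embedding (M ↾ suc p) M'
  snoc-embedding {M} {M'} {p} (diag , flip) (diag' , flip') e w w∉ wU wR = record
    { map = snoc (map e) w
    ; inj = λ i j → inj′ (view i) (view j)
    ; presU = λ i → presU′ (view i)
    ; presR = λ i j → presR′ (view i) (view j) }
    where
      g : ∀ {i : Fin (suc p)} → View i → ℕ
      g = snocᵛ (map e) w
      inj′ : ∀ {i j} (v : View i) (v' : View j) → g v ≡ g v' → i ≡ j
      inj′ ‵fromℕ ‵fromℕ _ = refl
      inj′ ‵fromℕ (‵inj₁ {i = y} _) eq = ⊥-elim (w∉ y (sym eq))
      inj′ (‵inj₁ {i = x} _) ‵fromℕ eq = ⊥-elim (w∉ x eq)
      inj′ (‵inj₁ {i = x} _) (‵inj₁ {i = y} _) eq = cong inject₁ (inj e x y eq)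
      presU′ : ∀ {i} (v : View i) → U M' (g v) ≡ U M (toℕ i)
      presU′ ‵fromℕ = trans wU (cong (U M) (sym (toℕ-fromℕ p)))
      presU′ (‵inj₁ {i = x} _) = trans (presU e x) (cong (U M) (sym (toℕ-inject₁ x)))
      presR′ : ∀ {i j} (v : View i) (v' : View j) → R M' (g v) (g v') ≡ R M (toℕ i) (toℕ j)
      presR′ ‵fromℕ ‵fromℕ = trans (diag' w) (sym (diag _))
      presR′ ‵fromℕ (‵inj₁ {i = y} _) =
        trans (wR y) (cong₂ (R M) (sym (toℕ-fromℕ p)) (sym (toℕ-inject₁ y)))
      presR′ (‵inj₁ {i = x} _) ‵fromℕ =
        trans (flip' (map e x) w) (trans (cong Flip (wR x))
          (trans (sym (flip (toℕ x) p)) (cong₂ (R M) (sym (toℕ-inject₁ x)) (sym (toℕ-fromℕ p)))))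
      presR′ (‵inj₁ {i = x} _) (‵inj₁ {i = y} _) =
        trans (presR e x y) (cong₂ (R M) (sym (toℕ-inject₁ x)) (sym (toℕ-inject₁ y)))

  module _ {𝓕 : List FinStruct} (irreducible : All Irreducible 𝓕)
           {K K' : Struct ℕ} (validK : Valid K) (forbK : InForb 𝓕 K)
           (validK' : Valid K') (forbK' : InForb 𝓕 K') (denseK' : LeftDense 𝓕 K') where

    realise : {p N a : ℕ} (g : Embedding (K ↾ p) (K' ↾ N)) → p ≤ a →
              Σ ℕ λ w → N ≤ w × Transports (map g) (code K a p) (code K' w N)
    realise {p} {N} {a} g p≤a =
      let (w , N≤w , w≋) = one-point-extension denseK' validK' t' realisable
      in w , N≤w , Transports-≋ʳ w≋ T
      where
        t' : Node N
        t' = push (map g) (code K a p)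
        T : Transports (map g) (code K a p) t'
        T = push-transports (code K a p) (inj g)
        realisable : InKM 𝓕 K' (λ _ → t') point
        realisable = Equivalence.to (transfer g (λ _ → T) point irreducible forbK')
                                    (InForb-reflect (BS-code-embedding validK p≤a) forbK)

    record InitialEmbedding (p : ℕ) : Set where
      field
        level : ℕ
        emb   : Embedding (K ↾ p) K'
        below : ∀ x → map emb x < level
        mono  : map emb Preserves Fin._<_ ⟶ _<_

      restricted : Embedding (K ↾ p) (K' ↾ level)
      restricted = ↾-restrict emb below

      restricted-mono : map restricted Preserves Fin._<_ ⟶ Fin._<_
      restricted-mono {x} {y} x<y =
        subst₂ _<_ (sym (toℕ-fromℕ< (below x))) (sym (toℕ-fromℕ< (below y))) (mono x<y)

    initial-embedding-step : {p : ℕ} → InitialEmbedding p → InitialEmbedding (suc p)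
    initial-embedding-step {p} A with realise (InitialEmbedding.restricted A) ≤-refl
    ... | w , N≤w , T = record
      { level = suc w
      ; emb = snoc-embedding {M = K} validK validK' emb w (λ x eq → <-irrefl eq (below-w x))
                             (Transports.unary T) wR
      ; below = λ i → belowᵛ (view i)
      ; mono = λ {i} {j} → monoᵛ (view i) (view j) }
      where
        open InitialEmbedding A
        below-w : ∀ x → map emb x < w
        below-w x = <-≤-trans (below x) N≤w
        wR : ∀ x → R K' w (map emb x) ≡ R K p (toℕ x)
        wR x = trans (cong (R K' w) (sym (toℕ-fromℕ< (below x)))) (Transports.image T x)
        belowᵛ : ∀ {i : Fin (suc p)} (v : View i) → snocᵛ (map emb) w v < suc w
        belowᵛ ‵fromℕ = n<1+n w
        belowᵛ (‵inj₁ {i = x} _) = m<n⇒m<1+n (below-w x)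
        monoᵛ : ∀ {i j : Fin (suc p)} (v : View i) (v' : View j) →
                i Fin.< j → snocᵛ (map emb) w v < snocᵛ (map emb) w v'
        monoᵛ ‵fromℕ ‵fromℕ i<j = ⊥-elim (<-irrefl refl i<j)
        monoᵛ ‵fromℕ (‵inj₁ {i = y} _) i<j = ⊥-elim (<⇒≱ i<j (≤fromℕ (inject₁ y)))
        monoᵛ (‵inj₁ {i = x} _) ‵fromℕ _ = below-w x
        monoᵛ (‵inj₁ {i = x} _) (‵inj₁ {i = y} _) i<j =
          mono (subst₂ _<_ (toℕ-inject₁ x) (toℕ-inject₁ y) i<j)

    initial-embedding : (p : ℕ) → InitialEmbedding p
    initial-embedding zero = record
      { level = 0
      ; emb = record { map = λ () ; inj = λ () ; presU = λ () ; presR = λ () }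
      ; below = λ ()
      ; mono = λ { {()} } }
    initial-embedding (suc p) = initial-embedding-step (initial-embedding p)

    P-⊆ : (d : ℕ) (ρ : Fin d → Fin ku) → PSubset 𝓕 d ρ K K'
    P-⊆ d ρ n s (increasing , coded , sorted) = level , s' , (increasing' , coded' , sorted') , same
      where
        open InitialEmbedding (initial-embedding n)
        witness : ∀ j → Σ ℕ λ w → level ≤ w ×
                    Transports (map restricted) (code K (proj₁ (coded j)) n) (code K' w level)
        witness j = realise restricted (proj₁ (proj₂ (coded j)))
        s' : Fin d → Node level
        s' j = code K' (proj₁ (witness j)) level
        T : ∀ j → Transports (map restricted) (s j) (s' j)
        T j = Transports-≋ˡ (proj₂ (proj₂ (coded j))) (proj₂ (proj₂ (witness j)))
        increasing' : ∀ i j → i Fin.< j → s' i ≺lex s' j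
        increasing' i j i<j = ≺lex-transport restricted-mono (T i) (T j) (increasing i j i<j)
        coded' : ∀ j → InCT K' level (s' j)
        coded' j = proj₁ (witness j) , proj₁ (proj₂ (witness j)) , refl , λ _ → refl
        sorted' : ∀ j → proj₁ (s' j) ≡ ρ j
        sorted' j = trans (Transports.unary (T j)) (sorted j)
        same : SameClass 𝓕 K s K' s'
        same m B _ = transfer restricted T B irreducible forbK'

proposition5p6 : (L : Lang) → let open Setting L in
    (𝓕 : List FinStruct) →
    All (λ F → Valid (proj₂ F) × Irreducible F) 𝓕 →
    NonDegenerate 𝓕 →
    (K K' : Struct ℕ) →
    IsFraisseLimit 𝓕 K → LeftDense 𝓕 K →
    IsFraisseLimit 𝓕 K' → LeftDense 𝓕 K' →
    (d : ℕ) (ρ : Fin d → Fin (Lang.ku L)) →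
    PEqual 𝓕 d ρ K K'
proposition5p6 L 𝓕 wellFormed _ K K' limitK denseK limitK' denseK' d ρ =
  P-⊆ irreducible (proj₁ limitK) forbK (proj₁ limitK') forbK' denseK' d ρ ,
  P-⊆ irreducible (proj₁ limitK') forbK' (proj₁ limitK) forbK denseK d ρ
  where
    open Setting L
    open Development L
    irreducible : All Irreducible 𝓕
    irreducible = All.map proj₂ wellFormed
    forbK : InForb 𝓕 K
    forbK = limit-InForb (All.map proj₁ wellFormed) limitK
    forbK' : InForb 𝓕 K'
    forbK' = limit-InForb (All.map proj₁ wellFormed) limitK'
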